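{- Let $s$ be a Bosbach state on a bounded pseudo-BCK algebra $A$ and let $K=\mathrm{Ker}(s)$. Then $A/K$ is $\vee_1$-commutative as well as $\vee_2$-commutative. In addition, $A/K$ is a $\vee$-semilattice and is good.
   Context: A pseudo-BCK algebra is a structure $(A,\le,\rightarrow,\rightsquigarrow,1)$ with $\le$ a binary relation, $\rightarrow,\rightsquigarrow$ binary operations and $1\in A$, such that for all $x,y,z\in A$: $x\rightarrow y\le (y\rightarrow z)\rightsquigarrow(x\rightarrow z)$ and $x\rightsquigarrow y\le (y\rightsquigarrow z)\rightarrow(x\rightsquigarrow z)$; $x\le (x\rightarrow y)\rightsquigarrow y$ and $x\le (x\rightsquigarrow y)\rightarrow y$; $x\le x$; $x\le 1$; antisymmetry of $\le$; $x\le y$ iff $x\rightarrow y=1$ iff $x\rightsquigarrow y=1$. Bounded: has least element $0$; $x^-=x\rightarrow0$, $x^\sim=x\rightsquigarrow 0$; a bounded pseudo-BCK algebra is good if $x^{ -\sim}=x^{\sim- }$ for all $x$. $x\vee_1 y=(x\rightarrow y)\rightsquigarrow y$, $x\vee_2 y=(x\rightsquigarrow y)\rightarrow y$; $\vee_i$-commutative means $x\vee_i y=y\vee_i x$ for all $x,y$. A Bosbach state is a map $s:A\to[0,1]$ with $s(x)+s(x\rightarrow y)=s(y)+s(y\rightarrow x)$, $s(x)+s(x\rightsquigarrow y)=s(y)+s(y\rightsquigarrow x)$, $s(0)=0$, $s(1)=1$; $\mathrm{Ker}(s)=\{a:s(a)=1\}$ is a normal filter (a set $F\ni1$ with $a,a\rightarrow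 b\in F\Rightarrow b\in F$ and $a\rightarrow b\in F\iff a\rightsquigarrow b\in F$), and $A/K$ is the quotient pseudo-BCK algebra by the congruence $a\Theta b\iff a\rightarrow b,\,b\rightarrow a\in K$. -}

module Defs where

open import Data.Product using (Σ; _×_; _,_; ∃)
open import Data.Sum using (_⊎_)
open import Relation.Binary.PropositionalEquality using (_≡_)
open import Relation.Nullary using (¬_)

-- The real numbers, axiomatised as a complete ordered field.
-- (agda-stdlib has no reals; the theorem is stated for every model of
-- these axioms, which by categoricity means: for ℝ.)

record CompleteOrderedField : Set₁ where
  infixl 6 _+_
  infixl 7 _*_
  infix  4 _≤ℝ_
  field
    ℝ   : Set
    _+_ : ℝ → ℝ → ℝ
    _*_ : ℝ → ℝ → ℝ
    -_  : ℝ → ℝ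
    0ℝ  : ℝ
    1ℝ  : ℝ
    _⁻¹ : (x : ℝ) → ¬ (x ≡ 0ℝ) → ℝ
    _≤ℝ_ : ℝ → ℝ → Set
    +-assoc   : ∀ x y z → (x + y) + z ≡ x + (y + z)
    +-comm    : ∀ x y → x + y ≡ y + x
    +-identʳ  : ∀ x → x + 0ℝ ≡ x
    +-invʳ    : ∀ x → x + (- x) ≡ 0ℝ
    *-assoc   : ∀ x y z → (x * y) * z ≡ x * (y * z)
    *-comm    : ∀ x y → x * y ≡ y * x
    *-identʳ  : ∀ x → x * 1ℝ ≡ x
    *-invʳ    : ∀ x (p : ¬ (x ≡ 0ℝ)) → x * (x ⁻¹) p ≡ 1ℝ
    distribˡ  : ∀ x y z → x * (y + z) ≡ (x * y) + (x * z)
    0≢1       : ¬ (0ℝ ≡ 1ℝ)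
    ≤-refl    : ∀ x → x ≤ℝ x
    ≤-antisym : ∀ x y → x ≤ℝ y → y ≤ℝ x → x ≡ y
    ≤-trans   : ∀ x y z → x ≤ℝ y → y ≤ℝ z → x ≤ℝ z
    ≤-total   : ∀ x y → (x ≤ℝ y) ⊎ (y ≤ℝ x)
    +-mono-≤  : ∀ x y z → x ≤ℝ y → x + z ≤ℝ y + z
    *-nonneg  : ∀ x y → 0ℝ ≤ℝ x → 0ℝ ≤ℝ y → 0ℝ ≤ℝ x * y
    complete  : (P : ℝ → Set) → ∃ P → (∃ λ b → ∀ x → P x → x ≤ℝ b) →
                ∃ λ u → (∀ x → P x → x ≤ℝ u) × (∀ b → (∀ x → P x → x ≤ℝ b) → u ≤ℝ b)

record PseudoBCK : Set₁ where
  infix  4 _≤_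
  infixr 5 _⇒_ _⇝_
  field
    Carrier : Set
    _≤_     : Carrier → Carrier → Set
    _⇒_     : Carrier → Carrier → Carrier
    _⇝_     : Carrier → Carrier → Carrier
    𝟙       : Carrier
    ax1     : ∀ x y z → (x ⇒ y) ≤ ((y ⇒ z) ⇝ (x ⇒ z))
    ax1'    : ∀ x y z → (x ⇝ y) ≤ ((y ⇝ z) ⇒ (x ⇝ z))
    ax2     : ∀ x y → x ≤ ((x ⇒ y) ⇝ y)
    ax2'    : ∀ x y → x ≤ ((x ⇝ y) ⇒ y)
    refl≤   : ∀ x → x ≤ x
    ≤𝟙      : ∀ x → x ≤ 𝟙
    antisym : ∀ x y → x ≤ y → y ≤ x → x ≡ y
    ≤→⇒     : ∀ x y → x ≤ y → (x ⇒ y) ≡ 𝟙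
    ⇒→≤     : ∀ x y → (x ⇒ y) ≡ 𝟙 → x ≤ y
    ≤→⇝     : ∀ x y → x ≤ y → (x ⇝ y) ≡ 𝟙
    ⇝→≤     : ∀ x y → (x ⇝ y) ≡ 𝟙 → x ≤ y

record BoundedPseudoBCK : Set₁ where
  field
    pbck : PseudoBCK
  open PseudoBCK pbck public
  field
    𝟘   : Carrier
    𝟘≤  : ∀ x → 𝟘 ≤ x

  _⁻ : Carrier → Carrier
  x ⁻ = x ⇒ 𝟘

  _∼ : Carrier → Carrier
  x ∼ = x ⇝ 𝟘

  _∨₁_ : Carrier → Carrier → Carrier
  x ∨₁ y = (x ⇒ y) ⇝ y

  _∨₂_ : Carrier → Carrier → Carrier
  x ∨₂ y = (x ⇝ y) ⇒ y

-- Bosbach states, kernel, and the quotient A/K (as a setoid on A)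

module _ (R : CompleteOrderedField) (A : BoundedPseudoBCK) where
  open CompleteOrderedField R
  open BoundedPseudoBCK A

  record BosbachState : Set where
    field
      s      : Carrier → ℝ
      s-ge0  : ∀ x → 0ℝ ≤ℝ s x
      s-le1  : ∀ x → s x ≤ℝ 1ℝ
      bos₁   : ∀ x y → s x + s (x ⇒ y) ≡ s y + s (y ⇒ x)
      bos₂   : ∀ x y → s x + s (x ⇝ y) ≡ s y + s (y ⇝ x)
      s𝟘     : s 𝟘 ≡ 0ℝ
      s𝟙     : s 𝟙 ≡ 1ℝ

  module Quotient (σ : BosbachState) where
    open BosbachState σ

    Ker : Carrier → Set
    Ker a = s a ≡ 1ℝ

    -- the congruence Θ_K : a Θ b iff a → b ∈ K and b → a ∈ K
    -- (equality of classes [a] = [b] in A/K)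
    _Θ_ : Carrier → Carrier → Set
    a Θ b = Ker (a ⇒ b) × Ker (b ⇒ a)

    -- order of A/K : [a] ≤ [b] iff [a] → [b] = [1] iff a → b ∈ K
    _≤K_ : Carrier → Carrier → Set
    a ≤K b = (a ⇒ b) Θ 𝟙

    ∨₁-commutativeK : Set
    ∨₁-commutativeK = ∀ x y → (x ∨₁ y) Θ (y ∨₁ x)

    ∨₂-commutativeK : Set
    ∨₂-commutativeK = ∀ x y → (x ∨₂ y) Θ (y ∨₂ x)

    ∨-semilatticeK : Set
    ∨-semilatticeK = ∀ x y → ∃ λ z → (x ≤K z) × (y ≤K z) ×
                     (∀ w → x ≤K w → y ≤K w → z ≤K w)

    goodK : Set
    goodK = ∀ x → ((x ⁻) ∼) Θ ((x ∼) ⁻)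

module Submission where

-- All four properties of A/K are statements
-- "a → b ∈ K", since [a] ≤ [b] in A/K iff a → b ∈ K.
--
-- The central
--     lemma is absorption: if y → x ∈ K then (x ∨₁ y) → x ∈ K (likewise for
--     ∨₂ with y ⇝ x ∈ K); it follows from the Bosbach identities, which give
--     s(x ∨₁ y) = s(x), and the fact that equal states on a comparable pair
--     put the implication into K.
--   * The theorem: commutativity is absorption applied to y ≤ y ∨ᵢ x,
--     x ∨₁ y is the least upper bound of x, y in A/K, and goodness is
--     absorption with y = 0, since x⁻∼ = x ∨₁ 0 and x∼⁻ = x ∨₂ 0.

open import Defs
open import Data.Product using (_×_; _,_; proj₂)
open import Relation.Binary.PropositionalEquality
  using (_≡_; sym; trans; cong; subst; subst₂; module ≡-Reasoning)

module OrderedFieldFacts (R : CompleteOrderedField) where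
  open CompleteOrderedField R

  +-neg-cancel : ∀ a c → (a + c) + (- c) ≡ a
  +-neg-cancel a c = trans (+-assoc a c (- c)) (trans (cong (a +_) (+-invʳ c)) (+-identʳ a))

  +-cancelʳ : ∀ {a b c} → a + c ≡ b + c → a ≡ b
  +-cancelʳ {a} {b} {c} p =
    trans (sym (+-neg-cancel a c)) (trans (cong (_+ (- c)) p) (+-neg-cancel b c))

  +-cancelˡ : ∀ {a b c} → c + a ≡ c + b → a ≡ b
  +-cancelˡ {a} {b} {c} p = +-cancelʳ (trans (+-comm a c) (trans p (+-comm c b)))

  ≤-cancelʳ : ∀ {a b c} → a + c ≤ℝ b + c → a ≤ℝ b
  ≤-cancelʳ {a} {b} {c} p = subst₂ _≤ℝ_ (+-neg-cancel a c) (+-neg-cancel b c) (+-mono-≤ _ _ (- c) p)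

  ≤-from-sum : ∀ {a b c} → c + 1ℝ ≡ b + a → a ≤ℝ 1ℝ → c ≤ℝ b
  ≤-from-sum {a} {b} {c} eq a≤1 = ≤-cancelʳ (subst (_≤ℝ b + 1ℝ) (sym eq)
    (subst₂ _≤ℝ_ (+-comm a b) (+-comm 1ℝ b) (+-mono-≤ a 1ℝ b a≤1)))

module PseudoBCKFacts (A : PseudoBCK) where
  open PseudoBCK A

  𝟙≤⇒≡𝟙 : ∀ {a} → 𝟙 ≤ a → a ≡ 𝟙
  𝟙≤⇒≡𝟙 {a} h = antisym a 𝟙 (≤𝟙 a) h

  ⇒-antitone : ∀ {x y z} → x ≤ y → (y ⇒ z) ≤ (x ⇒ z)
  ⇒-antitone {x} {y} {z} h = ⇝→≤ _ _ (𝟙≤⇒≡𝟙 (subst (_≤ _) (≤→⇒ x y h) (ax1 x y z)))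

  ⇝-antitone : ∀ {x y z} → x ≤ y → (y ⇝ z) ≤ (x ⇝ z)
  ⇝-antitone {x} {y} {z} h = ⇒→≤ _ _ (𝟙≤⇒≡𝟙 (subst (_≤ _) (≤→⇝ x y h) (ax1' x y z)))

  -- Transitivity of ≤, which is not among the axioms.
  ≤-trans : ∀ {x y z} → x ≤ y → y ≤ z → x ≤ z
  ≤-trans {x} {y} {z} p q =
    ⇒→≤ x z (𝟙≤⇒≡𝟙 (subst (_≤ (x ⇒ z)) (≤→⇒ y z q) (⇒-antitone p)))

  exchange⇒ : ∀ {x y z} → x ≤ (y ⇝ z) → y ≤ (x ⇒ z)
  exchange⇒ {x} {y} {z} h = ≤-trans (ax2' y z) (⇒-antitone h)

  exchange⇝ : ∀ {x y z} → x ≤ (y ⇒ z) → y ≤ (x ⇝ z)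
  exchange⇝ {x} {y} {z} h = ≤-trans (ax2 y z) (⇝-antitone h)

  ≤-⇒ : ∀ x y → y ≤ (x ⇒ y)
  ≤-⇒ x y = exchange⇒ (subst (x ≤_) (sym (≤→⇝ y y (refl≤ y))) (≤𝟙 x))

  ≤-⇝ : ∀ x y → y ≤ (x ⇝ y)
  ≤-⇝ x y = exchange⇝ (subst (x ≤_) (sym (≤→⇒ y y (refl≤ y))) (≤𝟙 x))

  𝟙⇒ : ∀ c → (𝟙 ⇒ c) ≡ c
  𝟙⇒ c = antisym _ _ (⇝→≤ _ _ (𝟙≤⇒≡𝟙 (ax2 𝟙 c))) (≤-⇒ 𝟙 c)

module KernelFacts (R : CompleteOrderedField) (A : BoundedPseudoBCK)
                   (σ : BosbachState R A) where
  open CompleteOrderedField R using (_+_; 1ℝ; +-comm; ≤-antisym)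
  open OrderedFieldFacts R
  open BoundedPseudoBCK A
  open PseudoBCKFacts pbck
  open BosbachState σ
  open Quotient R A σ

  Ker-⇒ : ∀ {a b} → a ≤ b → Ker (a ⇒ b)
  Ker-⇒ {a} {b} h = trans (cong s (≤→⇒ a b h)) s𝟙

  Ker-⇝ : ∀ {a b} → a ≤ b → Ker (a ⇝ b)
  Ker-⇝ {a} {b} h = trans (cong s (≤→⇝ a b h)) s𝟙

  -- K is closed under modus ponens for ⇝: s(u) + s(u ⇝ v) = 2 forces s(v) = 1.
  Ker-mp : ∀ {u v} → Ker u → Ker (u ⇝ v) → Ker v
  Ker-mp {u} {v} ku kuv = ≤-antisym _ _ (s-le1 v)
    (≤-from-sum (subst₂ (λ a b → a + b ≡ s v + s (v ⇝ u)) ku kuv (bos₂ u v)) (s-le1 _))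

  Ker-upward : ∀ {x y} → x ≤ y → Ker x → Ker y
  Ker-upward h kx = Ker-mp kx (Ker-⇝ h)

  Ker-⇒-trans : ∀ {a b c} → Ker (a ⇒ b) → Ker (b ⇒ c) → Ker (a ⇒ c)
  Ker-⇒-trans {a} {b} {c} p q = Ker-mp q (Ker-upward (ax1 a b c) p)

  Ker-⇒-of-equal-states : ∀ {a b} → b ≤ a → s a ≡ s b → Ker (a ⇒ b)
  Ker-⇒-of-equal-states {a} {b} h eq = +-cancelˡ (begin
    s b + s (a ⇒ b)   ≡⟨ cong (_+ s (a ⇒ b)) (sym eq) ⟩
    s a + s (a ⇒ b)   ≡⟨ bos₁ a b ⟩
    s b + s (b ⇒ a)   ≡⟨ cong (s b +_) (Ker-⇒ h) ⟩
    s b + 1ℝ          ∎)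
    where open ≡-Reasoning

  -- If y → x ∈ K then s(x ∨₁ y) = s(x): both s(x) and s(x ∨₁ y), added to
  -- s(x → y), give s(y) + 1 by the two Bosbach identities.
  s-∨₁ : ∀ {x y} → Ker (y ⇒ x) → s (x ∨₁ y) ≡ s x
  s-∨₁ {x} {y} k = sym (+-cancelʳ (begin
    s x + s (x ⇒ y)              ≡⟨ bos₁ x y ⟩
    s y + s (y ⇒ x)              ≡⟨ cong (s y +_) k ⟩
    s y + 1ℝ                     ≡⟨ cong (s y +_) (sym (Ker-⇝ (≤-⇒ x y))) ⟩
    s y + s (y ⇝ (x ⇒ y))        ≡⟨ sym (bos₂ (x ⇒ y) y) ⟩
    s (x ⇒ y) + s (x ∨₁ y)       ≡⟨ +-comm _ _ ⟩
    s (x ∨₁ y) + s (x ⇒ y)       ∎))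
    where open ≡-Reasoning

  s-∨₂ : ∀ {x y} → Ker (y ⇝ x) → s (x ∨₂ y) ≡ s x
  s-∨₂ {x} {y} k = sym (+-cancelʳ (begin
    s x + s (x ⇝ y)              ≡⟨ bos₂ x y ⟩
    s y + s (y ⇝ x)              ≡⟨ cong (s y +_) k ⟩
    s y + 1ℝ                     ≡⟨ cong (s y +_) (sym (Ker-⇒ (≤-⇝ x y))) ⟩
    s y + s (y ⇒ (x ⇝ y))        ≡⟨ sym (bos₁ (x ⇝ y) y) ⟩
    s (x ⇝ y) + s (x ∨₂ y)       ≡⟨ +-comm _ _ ⟩
    s (x ∨₂ y) + s (x ⇝ y)       ∎))
    where open ≡-Reasoning

  -- Absorption: if [y] ≤ [x] then [x ∨₁ y] = [x] (x ≤ x ∨₁ y always holds).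
  absorb₁ : ∀ {x y} → Ker (y ⇒ x) → Ker ((x ∨₁ y) ⇒ x)
  absorb₁ {x} {y} k = Ker-⇒-of-equal-states (ax2 x y) (s-∨₁ k)

  absorb₂ : ∀ {x y} → Ker (y ⇝ x) → Ker ((x ∨₂ y) ⇒ x)
  absorb₂ {x} {y} k = Ker-⇒-of-equal-states (ax2' x y) (s-∨₂ k)

  -- [a] ≤ [b] in A/K iff a → b ∈ K, because 1 → c = c.
  ≤K-of-Ker : ∀ {a b} → Ker (a ⇒ b) → a ≤K b
  ≤K-of-Ker {a} {b} k = Ker-⇒ (≤𝟙 _) , trans (cong s (𝟙⇒ _)) k

  Ker-of-≤K : ∀ {a b} → a ≤K b → Ker (a ⇒ b)
  Ker-of-≤K p = trans (cong s (sym (𝟙⇒ _))) (proj₂ p)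

module QuotientProperties (R : CompleteOrderedField) (A : BoundedPseudoBCK)
                          (σ : BosbachState R A) where
  open BoundedPseudoBCK A
  open PseudoBCKFacts pbck
  open Quotient R A σ
  open KernelFacts R A σ

  -- x ∨₁ y ≤ (y ∨₁ x) ∨₁ y by monotonicity, and the latter is absorbed
  -- into y ∨₁ x because y ≤ y ∨₁ x.
  ∨₁-comm-Ker : ∀ x y → Ker ((x ∨₁ y) ⇒ (y ∨₁ x))
  ∨₁-comm-Ker x y = Ker-⇒-trans
    (Ker-⇒ (⇝-antitone (⇒-antitone (≤-⇝ (y ⇒ x) x))))
    (absorb₁ (Ker-⇒ (ax2 y x)))

  ∨₂-comm-Ker : ∀ x y → Ker ((x ∨₂ y) ⇒ (y ∨₂ x))
  ∨₂-comm-Ker x y = Ker-⇒-trans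
    (Ker-⇒ (⇒-antitone (⇝-antitone (≤-⇒ (y ⇝ x) x))))
    (absorb₂ (Ker-⇝ (ax2' y x)))

  -- x ∨₁ y lies below every upper bound w of x and y in A/K:
  -- x ∨₁ y ≤ (x ∨₁ w) ∨₁ y, absorbed into x ∨₁ w since [y] ≤ [w] ≤ [x ∨₁ w],
  -- and [x ∨₁ w] = [w ∨₁ x] = [w] since [x] ≤ [w].
  ∨₁-least : ∀ {x y w} → Ker (x ⇒ w) → Ker (y ⇒ w) → Ker ((x ∨₁ y) ⇒ w)
  ∨₁-least {x} {y} {w} kx ky =
    Ker-⇒-trans (Ker-⇒ (⇝-antitone (⇒-antitone (ax2 x w))))
      (Ker-⇒-trans (absorb₁ (Ker-⇒-trans ky (Ker-⇒ (≤-⇝ (x ⇒ w) w))))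
        (Ker-⇒-trans (∨₁-comm-Ker x w) (absorb₁ kx)))

  -- x⁻∼ = x ∨₁ 0 and x∼⁻ = x ∨₂ 0; each is absorbed into x, which lies
  -- below the other.
  good-Ker₁ : ∀ x → Ker (((x ⁻) ∼) ⇒ ((x ∼) ⁻))
  good-Ker₁ x = Ker-⇒-trans (absorb₁ (Ker-⇒ (𝟘≤ x))) (Ker-⇒ (ax2' x 𝟘))

  good-Ker₂ : ∀ x → Ker (((x ∼) ⁻) ⇒ ((x ⁻) ∼))
  good-Ker₂ x = Ker-⇒-trans (absorb₂ (Ker-⇝ (𝟘≤ x))) (Ker-⇒ (ax2 x 𝟘))

  ∨₁-commutative : ∨₁-commutativeK
  ∨₁-commutative x y = ∨₁-comm-Ker x y , ∨₁-comm-Ker y x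

  ∨₂-commutative : ∨₂-commutativeK
  ∨₂-commutative x y = ∨₂-comm-Ker x y , ∨₂-comm-Ker y x

  ∨-semilattice : ∨-semilatticeK
  ∨-semilattice x y =
    (x ∨₁ y) , ≤K-of-Ker (Ker-⇒ (ax2 x y)) , ≤K-of-Ker (Ker-⇒ (≤-⇝ (x ⇒ y) y))
    , λ w x≤w y≤w → ≤K-of-Ker (∨₁-least (Ker-of-≤K x≤w) (Ker-of-≤K y≤w))

  good : goodK
  good x = good-Ker₁ x , good-Ker₂ x

proposition3p16 : (R : CompleteOrderedField) (A : BoundedPseudoBCK)
    (σ : BosbachState R A) →
    let open Quotient R A σ in
    ∨₁-commutativeK × ∨₂-commutativeK × ∨-semilatticeK × goodK
proposition3p16 R A σ = ∨₁-commutative , ∨₂-commutative , ∨-semilattice , good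
  where open QuotientProperties R A σ
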